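{- Let $\mathbb{F}$ be a field and let $f(\vec{x})=\sum_{\ell=1}^s\vec{L}_\ell(\vec{x})^{\vec{e}_\ell}\in\mathbb{F}[x_1,\ldots,x_n]$, where each $\vec{L}_\ell$ is a vector of affine functions of $\vec{x}$ and $\vec{e}_\ell$ is an exponent vector of the same length. Then $|\partial(f)|\le\sum_{\ell=1}^s|\vec{e}_\ell|_\times$.
   Context: For a vector of polynomials $\vec{L}=(L_1,\ldots,L_m)$ and $\vec{e}\in\mathbb{N}^m$, $\vec{L}^{\vec{e}}=L_1^{e_1}\cdots L_m^{e_m}$, and $|\vec{e}|_\times=\prod_{j=1}^m(e_j+1)$. Hasse derivative: for $\vec{u}\in\mathbb{F}^n$, $k\ge0$, $\partial_{\vec{u}^k}(f)$ is the coefficient of $y^k$ in $f(\vec{x}+\vec{u}y)$; $\partial_{x_j^k}=\partial_{\vec{e}_j^k}$ (standard basis vector); $\partial_{\vec{x}^{\vec{i}}}=\partial_{x_1^{i_1}}\cdots\partial_{x_n^{i_n}}$. $|\partial(f)|=\dim_{\mathbb{F}}\operatorname{span}\{\partial_{\vec{x}^{\vec{i}}}(f):\vec{i}\in\mathbb{N}^n\}$. -}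

module Defs where

open import Level using (Level; _⊔_)
open import Algebra.Bundles using (CommutativeRing)
open import Data.Nat as ℕ using (ℕ; zero; suc)
open import Data.Nat.Combinatorics using (_C_)
open import Data.Fin using (Fin)
open import Data.Vec using (Vec; []; _∷_; lookup; updateAt; zipWith; replicate; foldr; zip; allFin)
open import Data.Bool using (Bool; true; false; if_then_else_; _∧_)
open import Data.List using (List; []; _∷_; concatMap; map)
import Data.List as List
open import Data.Product using (Σ; _×_; ∃)
import Data.Product
import Data.Vec
open import Relation.Nullary using (¬_)
open import Relation.Binary.PropositionalEquality using (_≡_)

record Field (c ℓ : Level) : Set (Level.suc (c ⊔ ℓ)) where
  field
    commutativeRing : CommutativeRing c ℓ
  open CommutativeRing commutativeRing public
  field
    1≉0     : ¬ (1# ≈ 0#)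
    inverse : ∀ x → ¬ (x ≈ 0#) → Σ Carrier λ y → (x * y) ≈ 1#

module Poly {c ℓ : Level} (F : Field c ℓ) where
  open Field F using (Carrier; _≈_; _+_; _*_; 0#; 1#)

  Mono : ℕ → Set
  Mono n = Vec ℕ n

  -- polynomials in n variables, represented by their coefficient function
  -- (monomial ↦ coefficient); equality is coefficientwise.
  Poly : ℕ → Set c
  Poly n = Mono n → Carrier

  _≋_ : ∀ {n} → Poly n → Poly n → Set ℓ
  p ≋ q = ∀ m → p m ≈ q m

  _·ℕ_ : ℕ → Carrier → Carrier
  zero  ·ℕ x = 0#
  suc k ·ℕ x = x + (k ·ℕ x)

  below : ∀ {n} → Mono n → List (Mono n)
  below []      = [] ∷ []
  below (k ∷ m) = concatMap (λ a → map (_∷ a) (upto k)) (below m)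
    where
    upto : ℕ → List ℕ
    upto zero    = zero ∷ []
    upto (suc j) = suc j ∷ upto j

  sumL : List Carrier → Carrier
  sumL []       = 0#
  sumL (x ∷ xs) = x + sumL xs

  monoEq : ∀ {n} → Mono n → Mono n → Bool
  monoEq []      []        = true
  monoEq (a ∷ m) (b ∷ m')  = (a ℕ.≡ᵇ b) ∧ monoEq m m'

  monomialP : ∀ {n} → Mono n → Carrier → Poly n
  monomialP m₀ c m = if monoEq m m₀ then c else 0#

  _⊕_ : ∀ {n} → Poly n → Poly n → Poly n
  (p ⊕ q) m = p m + q m

  zeroP : ∀ {n} → Poly n
  zeroP _ = 0#

  constP : ∀ {n} → Carrier → Poly n
  constP {n} c = monomialP (replicate n 0) c

  _⊗_ : ∀ {n} → Poly n → Poly n → Poly n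
  (p ⊗ q) m = sumL (map (λ a → p a * q (zipWith ℕ._∸_ m a)) (below m))

  scaleP : ∀ {n} → Carrier → Poly n → Poly n
  scaleP c p m = c * p m

  sumP : ∀ {n k} → Vec (Poly n) k → Poly n
  sumP = foldr _ _⊕_ zeroP

  prodP : ∀ {n k} → Vec (Poly n) k → Poly n
  prodP = foldr _ _⊗_ (constP 1#)

  unitMono : ∀ {n} → Fin n → Mono n
  unitMono {n} j = updateAt (replicate n 0) j (λ _ → 1)

  varP : ∀ {n} → Fin n → Poly n
  varP j = monomialP (unitMono j) 1#

  _^P_ : ∀ {n} → Poly n → ℕ → Poly n
  p ^P zero  = constP 1#
  p ^P suc k = p ⊗ (p ^P k)

  record Affine (n : ℕ) : Set c where
    constructor affine
    field
      const : Carrier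
      lin   : Vec Carrier n

  affineP : ∀ {n} → Affine n → Poly n
  affineP {n} (affine a₀ a) =
    constP a₀ ⊕ sumP (zipWith scaleP a (Data.Vec.map varP (allFin n)))

  powVec : ∀ {n k} → Vec (Affine n) k → Vec ℕ k → Poly n
  powVec L e = prodP (zipWith (λ Lj ej → affineP Lj ^P ej) L e)

  record Term (n : ℕ) : Set c where
    constructor term
    field
      len : ℕ
      L   : Vec (Affine n) len
      e   : Vec ℕ len

  termP : ∀ {n} → Term n → Poly n
  termP (term _ L e) = powVec L e

  sumTerms : ∀ {n} → List (Term n) → Poly n
  sumTerms []       = zeroP
  sumTerms (t ∷ ts) = termP t ⊕ sumTerms ts

  -- |e|_× = Π_j (e_j + 1)
  prodSuc : ∀ {k} → Vec ℕ k → ℕ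
  prodSuc = foldr _ (λ a r → suc a ℕ.* r) 1

  weight : ∀ {n} → Term n → ℕ
  weight (term _ _ e) = prodSuc e

  -- Hasse derivative ∂_{x_j^k}: coefficient of y^k in f(x + e_j y).
  -- Coefficientwise: coefficient of x^m is C(m_j + k, k) · f_{m + k e_j}.
  hasse1 : ∀ {n} → Fin n → ℕ → Poly n → Poly n
  hasse1 j k p m = ((lookup m j ℕ.+ k) C k) ·ℕ p (updateAt m j (ℕ._+ k))

  hasse : ∀ {n} → Mono n → Poly n → Poly n
  hasse {n} i p = foldr _ (λ jk q → hasse1 (Data.Product.proj₁ jk) (Data.Product.proj₂ jk) q) p (zip (allFin n) i)

  linComb : ∀ {n B} → Vec Carrier B → Vec (Poly n) B → Poly n
  linComb cs gs = sumP (zipWith scaleP cs gs)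

  -- dim_F span {P i : i ∈ I} ≤ B : some B polynomials span every P i
  DimSpanLE : ∀ {n} {a} {I : Set a} → (I → Poly n) → ℕ → Set (c ⊔ ℓ ⊔ a)
  DimSpanLE {n} {I = I} P B =
    Σ (Vec (Poly n) B) λ gs → ∀ i → Σ (Vec Carrier B) λ cs → linComb cs gs ≋ P i

  DerivDimLE : ∀ {n} → Poly n → ℕ → Set (c ⊔ ℓ)
  DerivDimLE {n} f B = DimSpanLE {I = Mono n} (λ i → hasse i f) B

-- Let G be the family of the products L_ℓ^d with d ≤ e_ℓ componentwise: it has Σ_ℓ |e_ℓ|_×
-- members and contains every summand of f. By the Leibniz rule
--   ∂_{x_j^k}(g h) = Σ_{b ≤ k} ∂_{x_j^b} g · ∂_{x_j^{k-b}} h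
-- and since ∂_{x_j^b} of an affine function is the function itself, a constant or 0, each
-- ∂_{x_j^k} maps span G into itself. So every ∂_{x^i} f lies in span G, whose dimension is at
-- most |G|. The Leibniz rule for coefficient functions reduces, one coordinate at a time, to a
-- one-variable identity, which after reindexing is Vandermonde's convolution of binomials.

module Submission where

open import Defs
open import Level using (Level; _⊔_)
open import Algebra.Bundles using (CommutativeMonoid)
open import Data.Bool using (true; false; _∧_)
open import Data.Bool.Properties using (∧-zeroʳ)
open import Data.Fin as Fin using (Fin; zero; suc)
open import Data.List using (List; []; _∷_; map; concatMap; downFrom; _++_)
open import Data.List.Relation.Unary.Any as Any using (Any)
open import Data.Nat as ℕ using (ℕ; zero; suc; _∸_; z≤n; s≤s)
import Data.Nat.Properties as ℕ
open import Data.Nat.Combinatorics using (_C_; nCk+nC[k+1]≡[n+1]C[k+1]; nCn≡1; nCk≡nC[n∸k]; k>n⇒nCk≡0)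
open import Data.Nat.ListAction using (sum)
open import Data.Product using (Σ; _,_)
import Data.Product as Σ
open import Data.Sum using (_⊎_; inj₁; inj₂)
open import Data.Vec using (Vec; []; _∷_; lookup; updateAt; zipWith; replicate)
import Data.Vec as Vec
open import Data.Vec.Properties using (updateAt-id-local)
open import Data.Vec.Relation.Binary.Pointwise.Inductive as Pointwise using (Pointwise; []; _∷_)
open import Data.Vec.Relation.Unary.Any using (here; there)
open import Data.Vec.Membership.Propositional using (_∈_)
open import Data.Vec.Membership.Propositional.Properties using (∈-map⁺; ∈-++⁺ˡ; ∈-++⁺ʳ)
open import Function using (_∘_)
open import Relation.Binary.PropositionalEquality as ≡ using (_≡_; _≢_)
open import Relation.Nullary using (yes; no; contradiction)
import Algebra.Properties.CommutativeSemigroup ℕ.+-commutativeSemigroup as ℕ-+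

module RangeSum {c ℓ} (M : CommutativeMonoid c ℓ) where
  open CommutativeMonoid M renaming (_∙_ to _+_; ε to 0#)
  open import Algebra.Properties.CommutativeSemigroup commutativeSemigroup
    using (interchange)

  ∑< : ℕ → (ℕ → Carrier) → Carrier
  ∑< zero    f = 0#
  ∑< (suc n) f = f 0 + ∑< n (λ i → f (suc i))

  syntax ∑< n (λ i → e) = ∑[ i < n ] e

  ∑-cong-< : ∀ n {f g} → (∀ i → i ℕ.< n → f i ≈ g i) → ∑< n f ≈ ∑< n g
  ∑-cong-< zero    f≈g = refl
  ∑-cong-< (suc n) f≈g = ∙-cong (f≈g 0 (s≤s z≤n)) (∑-cong-< n (λ i i<n → f≈g (suc i) (s≤s i<n)))

  ∑-cong : ∀ n {f g} → (∀ i → f i ≈ g i) → ∑< n f ≈ ∑< n g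
  ∑-cong n f≈g = ∑-cong-< n (λ i _ → f≈g i)

  ∑-zero-< : ∀ n {f} → (∀ i → i ℕ.< n → f i ≈ 0#) → ∑< n f ≈ 0#
  ∑-zero-< zero    f≈0 = refl
  ∑-zero-< (suc n) f≈0 =
    trans (∙-cong (f≈0 0 (s≤s z≤n)) (∑-zero-< n (λ i i<n → f≈0 (suc i) (s≤s i<n)))) (identityˡ 0#)

  ∑-distrib-+ : ∀ n f g → ∑[ i < n ] (f i + g i) ≈ ∑< n f + ∑< n g
  ∑-distrib-+ zero    f g = sym (identityˡ 0#)
  ∑-distrib-+ (suc n) f g = trans (∙-congˡ (∑-distrib-+ n _ _)) (interchange (f 0) (g 0) _ _)

  ∑-split : ∀ a b f → ∑< (a ℕ.+ b) f ≈ ∑< a f + ∑[ i < b ] f (a ℕ.+ i)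
  ∑-split zero    b f = sym (identityˡ _)
  ∑-split (suc a) b f = trans (∙-congˡ (∑-split a b (λ i → f (suc i)))) (sym (assoc _ _ _))

  ∑-last : ∀ n f → ∑< (suc n) f ≈ ∑< n f + f n
  ∑-last zero    f = comm (f 0) 0#
  ∑-last (suc n) f = trans (∙-congˡ (∑-last n (λ i → f (suc i)))) (sym (assoc _ _ _))

  ∑-comm : ∀ a b (f : ℕ → ℕ → Carrier) → ∑[ i < a ] ∑[ j < b ] f i j ≈ ∑[ j < b ] ∑[ i < a ] f i j
  ∑-comm zero    b f = sym (∑-zero-< b (λ _ _ → refl))
  ∑-comm (suc a) b f =
    trans (∙-congˡ (∑-comm a b (λ i → f (suc i)))) (sym (∑-distrib-+ b (f 0) _))

module ℕ-Sum = RangeSum ℕ.+-0-commutativeMonoid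

module Binomial where
  open ℕ-Sum using (∑<)

  -- Unlike `_C_`, this form computes on `suc n` and `suc k`.
  binom : ℕ → ℕ → ℕ
  binom n       zero    = 1
  binom zero    (suc k) = 0
  binom (suc n) (suc k) = binom n k ℕ.+ binom n (suc k)

  C≡binom : ∀ n k → n C k ≡ binom n k
  C≡binom n       zero    = ≡.trans (nCk≡nC[n∸k] {0} {n} z≤n) (nCn≡1 n)
  C≡binom zero    (suc k) = k>n⇒nCk≡0 {0} {suc k} (s≤s z≤n)
  C≡binom (suc n) (suc k) =
    ≡.trans (≡.sym (nCk+nC[k+1]≡[n+1]C[k+1] n k)) (≡.cong₂ ℕ._+_ (C≡binom n k) (C≡binom n (suc k)))

  binom-< : ∀ {n k} → n ℕ.< k → binom n k ≡ 0
  binom-< {zero}  {suc k} _         = ≡.refl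
  binom-< {suc n} {suc k} (s≤s n<k) = ≡.cong₂ ℕ._+_ (binom-< n<k) (binom-< (ℕ.m<n⇒m<1+n n<k))

  vandermonde : ∀ c d k → ∑[ b < suc k ] (binom c b ℕ.* binom d (k ∸ b)) ≡ binom (c ℕ.+ d) k
  vandermonde zero    d k       =
    ≡.trans (≡.cong₂ ℕ._+_ (ℕ.+-identityʳ (binom d k)) (ℕ-Sum.∑-zero-< k (λ _ _ → ≡.refl)))
            (ℕ.+-identityʳ _)
  vandermonde (suc c) d zero    = ≡.refl
  vandermonde (suc c) d (suc k) = begin
      1 ℕ.* binom d (suc k) ℕ.+ ∑[ b < suc k ] ((binom c b ℕ.+ binom c (suc b)) ℕ.* binom d (k ∸ b))
    ≡⟨ ≡.cong (1 ℕ.* binom d (suc k) ℕ.+_) (≡.trans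
         (ℕ-Sum.∑-cong (suc k) {g = λ b → lower b ℕ.+ upper b}
           (λ b → ℕ.*-distribʳ-+ (binom d (k ∸ b)) (binom c b) (binom c (suc b))))
         (ℕ-Sum.∑-distrib-+ (suc k) lower upper)) ⟩
      1 ℕ.* binom d (suc k) ℕ.+ (∑< (suc k) lower ℕ.+ ∑< (suc k) upper)
    ≡⟨ ℕ-+.x∙yz≈y∙xz (1 ℕ.* binom d (suc k)) (∑< (suc k) lower) (∑< (suc k) upper) ⟩
      ∑< (suc k) lower ℕ.+ (1 ℕ.* binom d (suc k) ℕ.+ ∑< (suc k) upper)
    ≡⟨ ≡.cong₂ ℕ._+_ (vandermonde c d k) (vandermonde c d (suc k)) ⟩
      binom (c ℕ.+ d) k ℕ.+ binom (c ℕ.+ d) (suc k)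
    ∎
    where
    open ≡.≡-Reasoning
    lower upper : ℕ → ℕ
    lower b = binom c b ℕ.* binom d (k ∸ b)
    upper b = binom c (suc b) ℕ.* binom d (k ∸ b)

open Binomial

∸-middle : ∀ m₀ b r {i} → i ℕ.≤ m₀ → m₀ ℕ.+ (b ℕ.+ r) ∸ (i ℕ.+ b) ≡ m₀ ∸ i ℕ.+ r
∸-middle m₀ b r {i} i≤m₀ = begin-equality
  m₀ ℕ.+ (b ℕ.+ r) ∸ (i ℕ.+ b)    ≡⟨ ≡.cong₂ _∸_ (ℕ-+.x∙yz≈y∙xz m₀ b r) (ℕ.+-comm i b) ⟩
  b ℕ.+ (m₀ ℕ.+ r) ∸ (b ℕ.+ i)    ≡⟨ ℕ.[m+n]∸[m+o]≡n∸o b (m₀ ℕ.+ r) i ⟩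
  m₀ ℕ.+ r ∸ i                    ≡⟨ ℕ.+-∸-comm r i≤m₀ ⟩
  m₀ ∸ i ℕ.+ r                    ∎
  where open ℕ.≤-Reasoning

∸-tail-< : ∀ m₀ b {r i} → i ℕ.< r → m₀ ℕ.+ (b ℕ.+ r) ∸ (b ℕ.+ (suc m₀ ℕ.+ i)) ℕ.< r
∸-tail-< m₀ b {r} {i} i<r = begin-strict
  m₀ ℕ.+ (b ℕ.+ r) ∸ (b ℕ.+ (suc m₀ ℕ.+ i))
    ≡⟨ ≡.cong (_∸ (b ℕ.+ (suc m₀ ℕ.+ i))) (ℕ-+.x∙yz≈y∙xz m₀ b r) ⟩
  b ℕ.+ (m₀ ℕ.+ r) ∸ (b ℕ.+ (suc m₀ ℕ.+ i))
    ≡⟨ ℕ.[m+n]∸[m+o]≡n∸o b (m₀ ℕ.+ r) (suc m₀ ℕ.+ i) ⟩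
  m₀ ℕ.+ r ∸ (suc m₀ ℕ.+ i)
    ≡⟨ ≡.cong (m₀ ℕ.+ r ∸_) (≡.sym (ℕ.+-suc m₀ i)) ⟩
  m₀ ℕ.+ r ∸ (m₀ ℕ.+ suc i)
    ≡⟨ ℕ.[m+n]∸[m+o]≡n∸o m₀ r (suc i) ⟩
  r ∸ suc i
    <⟨ ℕ.∸-monoʳ-< (s≤s z≤n) i<r ⟩
  r ∎
  where open ℕ.≤-Reasoning

module PolyTheory {c ℓ} (F : Field c ℓ) where
  open Field F hiding (zero)
  open Poly F
  open RangeSum +-commutativeMonoid
  open import Algebra.Definitions.RawMonoid +-rawMonoid using (_×_)
  open import Algebra.Properties.Semiring.Mult semiring
    using (×-congʳ; ×-congˡ; ×-homo-+; ×-homo-1; ×-assocˡ; ×-assoc-*; ×-comm-*)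
  open import Algebra.Properties.CommutativeMonoid.Mult +-commutativeMonoid using (×-distrib-+)
  open import Algebra.Properties.CommutativeSemigroup +-commutativeSemigroup using (interchange)
  open import Relation.Binary.Reasoning.Setoid setoid

  ·ℕ≡× : ∀ k x → k ·ℕ x ≡ k × x
  ·ℕ≡× zero    x = ≡.refl
  ·ℕ≡× (suc k) x = ≡.cong (x +_) (·ℕ≡× k x)

  ×-zeroʳ : ∀ k → k × 0# ≈ 0#
  ×-zeroʳ zero    = refl
  ×-zeroʳ (suc k) = trans (+-congˡ (×-zeroʳ k)) (+-identityˡ 0#)

  ×-distrib-∑ : ∀ k n f → k × ∑< n f ≈ ∑[ i < n ] (k × f i)
  ×-distrib-∑ k zero    f = ×-zeroʳ k
  ×-distrib-∑ k (suc n) f = trans (×-distrib-+ _ _ k) (+-congˡ (×-distrib-∑ k n _))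

  ∑-× : ∀ n (f : ℕ → ℕ) x → ∑[ i < n ] (f i × x) ≈ ℕ-Sum.∑< n f × x
  ∑-× zero    f x = refl
  ∑-× (suc n) f x = trans (+-congˡ (∑-× n _ x)) (sym (×-homo-+ x (f 0) _))

  ∑ₗ : ∀ {A : Set} → List A → (A → Carrier) → Carrier
  ∑ₗ xs f = sumL (map f xs)

  syntax ∑ₗ xs (λ a → e) = ∑[ a ∈ xs ] e

  private variable A B : Set

  ∑ₗ-cong : ∀ (xs : List A) {f g} → (∀ a → f a ≈ g a) → ∑ₗ xs f ≈ ∑ₗ xs g
  ∑ₗ-cong []       f≈g = refl
  ∑ₗ-cong (x ∷ xs) f≈g = +-cong (f≈g x) (∑ₗ-cong xs f≈g)

  ∑ₗ-zero : ∀ (xs : List A) {f} → (∀ a → f a ≈ 0#) → ∑ₗ xs f ≈ 0#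
  ∑ₗ-zero []       f≈0 = refl
  ∑ₗ-zero (x ∷ xs) f≈0 = trans (+-cong (f≈0 x) (∑ₗ-zero xs f≈0)) (+-identityˡ 0#)

  ∑ₗ-distrib-+ : ∀ (xs : List A) f g → ∑[ a ∈ xs ] (f a + g a) ≈ ∑ₗ xs f + ∑ₗ xs g
  ∑ₗ-distrib-+ []       f g = sym (+-identityˡ 0#)
  ∑ₗ-distrib-+ (x ∷ xs) f g = trans (+-congˡ (∑ₗ-distrib-+ xs f g)) (interchange (f x) (g x) _ _)

  *-distribˡ-∑ₗ : ∀ (xs : List A) x f → x * ∑ₗ xs f ≈ ∑[ a ∈ xs ] (x * f a)
  *-distribˡ-∑ₗ []       x f = zeroʳ x
  *-distribˡ-∑ₗ (y ∷ xs) x f = trans (distribˡ x _ _) (+-congˡ (*-distribˡ-∑ₗ xs x f))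

  ×-distrib-∑ₗ : ∀ (xs : List A) k f → k × ∑ₗ xs f ≈ ∑[ a ∈ xs ] (k × f a)
  ×-distrib-∑ₗ []       k f = ×-zeroʳ k
  ×-distrib-∑ₗ (y ∷ xs) k f = trans (×-distrib-+ _ _ k) (+-congˡ (×-distrib-∑ₗ xs k f))

  ∑ₗ-++ : ∀ (xs ys : List A) f → ∑ₗ (xs ++ ys) f ≈ ∑ₗ xs f + ∑ₗ ys f
  ∑ₗ-++ []       ys f = sym (+-identityˡ _)
  ∑ₗ-++ (x ∷ xs) ys f = trans (+-congˡ (∑ₗ-++ xs ys f)) (sym (+-assoc _ _ _))

  ∑ₗ-map : ∀ (g : A → B) (xs : List A) f → ∑ₗ (map g xs) f ≈ ∑[ a ∈ xs ] f (g a)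
  ∑ₗ-map g []       f = refl
  ∑ₗ-map g (x ∷ xs) f = +-congˡ (∑ₗ-map g xs f)

  ∑ₗ-concatMap : ∀ (g : A → List B) (xs : List A) f →
                 ∑ₗ (concatMap g xs) f ≈ ∑[ a ∈ xs ] ∑ₗ (g a) f
  ∑ₗ-concatMap g []       f = refl
  ∑ₗ-concatMap g (x ∷ xs) f = trans (∑ₗ-++ (g x) (concatMap g xs) f) (+-congˡ (∑ₗ-concatMap g xs f))

  ∑ₗ-∑-comm : ∀ (xs : List A) n (f : A → ℕ → Carrier) →
              ∑[ a ∈ xs ] ∑[ i < n ] f a i ≈ ∑[ i < n ] ∑[ a ∈ xs ] f a i
  ∑ₗ-∑-comm []       n f = sym (∑-zero-< n (λ _ _ → refl))
  ∑ₗ-∑-comm (x ∷ xs) n f =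
    trans (+-congˡ (∑ₗ-∑-comm xs n f)) (sym (∑-distrib-+ n (f x) (λ i → ∑[ a ∈ xs ] f a i)))

  ∑ₗ-downFrom : ∀ n f → ∑ₗ (downFrom n) f ≈ ∑< n f
  ∑ₗ-downFrom zero    f = refl
  ∑ₗ-downFrom (suc n) f = trans (+-congˡ (∑ₗ-downFrom n f)) (trans (+-comm _ _) (sym (∑-last n f)))

  ×-* : ∀ a b x y → (a × x) * (b × y) ≈ (a ℕ.* b) × (x * y)
  ×-* a b x y = begin
    (a × x) * (b × y)    ≈⟨ ×-assoc-* a x (b × y) ⟩
    a × (x * (b × y))    ≈⟨ ×-congʳ a (×-comm-* b x y) ⟩
    a × (b × (x * y))    ≈⟨ ×-assocˡ (x * y) a b ⟩
    (a ℕ.* b) × (x * y)  ∎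

  _⋆_ : (ℕ → Carrier) → (ℕ → Carrier) → ℕ → Carrier
  (p ⋆ q) N = ∑[ i < suc N ] (p i * q (N ∸ i))

  ∂₁ : ℕ → (ℕ → Carrier) → ℕ → Carrier
  ∂₁ k p i = binom (i ℕ.+ k) k × p (i ℕ.+ k)

  module _ (p q : ℕ → Carrier) where

    private
      summand : ℕ → ℕ → ℕ → ℕ → Carrier
      summand N k b c = (binom c b ℕ.* binom (N ∸ c) (k ∸ b)) × (p c * q (N ∸ c))

    -- Put c = b + i; the terms with c < b, or with N ∸ c < k ∸ b, vanish.
    ⋆-∂₁-reindex : ∀ m₀ {b k} → b ℕ.≤ k →
      ∑[ c < suc (m₀ ℕ.+ k) ] summand (m₀ ℕ.+ k) k b c ≈ (∂₁ b p ⋆ ∂₁ (k ∸ b) q) m₀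
    ⋆-∂₁-reindex m₀ {b} b≤k with ℕ.m≤n⇒∃[o]m+o≡n b≤k
    ... | r , ≡.refl rewrite ℕ.m+n∸m≡n b r = begin
        ∑[ c < suc N ] T c
      ≡⟨ ≡.cong (λ n → ∑< n T) (≡.trans (≡.cong suc (ℕ-+.x∙yz≈y∙xz m₀ b r))
                                         (≡.sym (ℕ.+-suc b (m₀ ℕ.+ r)))) ⟩
        ∑< (b ℕ.+ (suc m₀ ℕ.+ r)) T
      ≈⟨ ∑-split b (suc m₀ ℕ.+ r) T ⟩
        ∑< b T + ∑[ i < suc m₀ ℕ.+ r ] T (b ℕ.+ i)
      ≈⟨ +-cong (∑-zero-< b below-b) (∑-split (suc m₀) r (λ i → T (b ℕ.+ i))) ⟩
        0# + (∑[ i < suc m₀ ] T (b ℕ.+ i) + ∑[ i < r ] T (b ℕ.+ (suc m₀ ℕ.+ i)))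
      ≈⟨ trans (+-identityˡ _) (+-congˡ (∑-zero-< r above-m₀)) ⟩
        ∑[ i < suc m₀ ] T (b ℕ.+ i) + 0#
      ≈⟨ trans (+-identityʳ _) (∑-cong-< (suc m₀) middle) ⟩
        (∂₁ b p ⋆ ∂₁ r q) m₀
      ∎
      where
      N = m₀ ℕ.+ (b ℕ.+ r)
      T : ℕ → Carrier
      T c = (binom c b ℕ.* binom (N ∸ c) r) × (p c * q (N ∸ c))
      below-b : ∀ i → i ℕ.< b → T i ≈ 0#
      below-b i i<b = ×-congˡ (≡.cong (ℕ._* binom (N ∸ i) r) (binom-< i<b))
      above-m₀ : ∀ i → i ℕ.< r → T (b ℕ.+ (suc m₀ ℕ.+ i)) ≈ 0#
      above-m₀ i i<r = ×-congˡ (≡.trans (≡.cong (binom c′ b ℕ.*_) (binom-< (∸-tail-< m₀ b i<r)))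
                                        (ℕ.*-zeroʳ (binom c′ b)))
        where c′ = b ℕ.+ (suc m₀ ℕ.+ i)
      middle : ∀ i → i ℕ.< suc m₀ → T (b ℕ.+ i) ≈ ∂₁ b p i * ∂₁ r q (m₀ ∸ i)
      middle i (s≤s i≤m₀) rewrite ℕ.+-comm b i | ∸-middle m₀ b r i≤m₀ =
        sym (×-* (binom (i ℕ.+ b) b) (binom (m₀ ∸ i ℕ.+ r) r) (p (i ℕ.+ b)) (q (m₀ ∸ i ℕ.+ r)))

    leibniz₁ : ∀ m₀ k → ∂₁ k (p ⋆ q) m₀ ≈ ∑[ b < suc k ] (∂₁ b p ⋆ ∂₁ (k ∸ b) q) m₀
    leibniz₁ m₀ k = begin
        binom N k × ∑< (suc N) pq
      ≈⟨ ×-distrib-∑ (binom N k) (suc N) pq ⟩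
        ∑[ c < suc N ] (binom N k × pq c)
      ≈⟨ ∑-cong-< (suc N) {g = λ c → ℕ-Sum.∑< (suc k) (coeff c) × pq c}
           (λ c c<1+N → ×-congˡ (≡.sym (vandermonde-at (ℕ.≤-pred c<1+N)))) ⟩
        ∑[ c < suc N ] (ℕ-Sum.∑< (suc k) (coeff c) × pq c)
      ≈⟨ ∑-cong (suc N) (λ c → sym (∑-× (suc k) (coeff c) (pq c))) ⟩
        ∑[ c < suc N ] ∑[ b < suc k ] summand N k b c
      ≈⟨ ∑-comm (suc N) (suc k) (λ c b → summand N k b c) ⟩
        ∑[ b < suc k ] ∑[ c < suc N ] summand N k b c
      ≈⟨ ∑-cong-< (suc k) (λ b b<1+k → ⋆-∂₁-reindex m₀ (ℕ.≤-pred b<1+k)) ⟩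
        ∑[ b < suc k ] (∂₁ b p ⋆ ∂₁ (k ∸ b) q) m₀
      ∎
      where
      N = m₀ ℕ.+ k
      pq : ℕ → Carrier
      pq c = p c * q (N ∸ c)
      coeff : ℕ → ℕ → ℕ
      coeff c b = binom c b ℕ.* binom (N ∸ c) (k ∸ b)
      vandermonde-at : ∀ {c} → c ℕ.≤ N → ℕ-Sum.∑< (suc k) (coeff c) ≡ binom N k
      vandermonde-at {c} c≤N =
        ≡.trans (vandermonde c (N ∸ c) k) (≡.cong (λ n → binom n k) (ℕ.m+[n∸m]≡n c≤N))

  _∸ᵛ_ : ∀ {n} → Mono n → Mono n → Mono n
  m ∸ᵛ a = zipWith _∸_ m a

  -- `below` runs through the first coordinate with a list local to its definition; the heads of
  -- `below (k ∷ [])` expose that list.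
  private
    heads-of-singletons : ∀ (xs : List ℕ) → map Vec.head (map (_∷ []) xs ++ []) ≡ xs
    heads-of-singletons []       = ≡.refl
    heads-of-singletons (x ∷ xs) = ≡.cong (x ∷_) (heads-of-singletons xs)

    heads-below≡downFrom : ∀ k → map Vec.head (below (k ∷ [])) ≡ downFrom (suc k)
    heads-below≡downFrom zero    = ≡.refl
    heads-below≡downFrom (suc k) = ≡.cong (suc k ∷_) (heads-below≡downFrom k)

    concatMap-cons-cong : ∀ {n} {xs ys : List ℕ} (as : List (Mono n)) → xs ≡ ys →
      concatMap (λ a → map (_∷ a) xs) as ≡ concatMap (λ a → map (_∷ a) ys) as
    concatMap-cons-cong as ≡.refl = ≡.refl

  below-∷ : ∀ {n} k (m : Mono n) →
            below (k ∷ m) ≡ concatMap (λ a → map (_∷ a) (downFrom (suc k))) (below m)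
  below-∷ k m = concatMap-cons-cong (below m)
    (≡.trans (≡.sym (heads-of-singletons _)) (heads-below≡downFrom k))

  ⊗-∷≈∑⋆ : ∀ {n} (P Q : Poly (suc n)) m₀ (m : Mono n) →
           (P ⊗ Q) (m₀ ∷ m) ≈ ∑[ a ∈ below m ] ((λ i → P (i ∷ a)) ⋆ (λ i → Q (i ∷ (m ∸ᵛ a)))) m₀
  ⊗-∷≈∑⋆ P Q m₀ m = begin
      ∑ₗ (below (m₀ ∷ m)) h
    ≡⟨ ≡.cong (λ xs → ∑ₗ xs h) (below-∷ m₀ m) ⟩
      ∑ₗ (concatMap (λ a → map (_∷ a) (downFrom (suc m₀))) (below m)) h
    ≈⟨ ∑ₗ-concatMap (λ a → map (_∷ a) (downFrom (suc m₀))) (below m) h ⟩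
      ∑[ a ∈ below m ] ∑ₗ (map (_∷ a) (downFrom (suc m₀))) h
    ≈⟨ ∑ₗ-cong (below m) (λ a → trans (∑ₗ-map (_∷ a) (downFrom (suc m₀)) h)
                                      (∑ₗ-downFrom (suc m₀) (λ i → h (i ∷ a)))) ⟩
      ∑[ a ∈ below m ] ((λ i → P (i ∷ a)) ⋆ (λ i → Q (i ∷ (m ∸ᵛ a)))) m₀
    ∎
    where
    h : Mono _ → Carrier
    h a = P a * Q ((m₀ ∷ m) ∸ᵛ a)

  ⊗-∷≈∑⊗ : ∀ {n} (P Q : Poly (suc n)) m₀ (m : Mono n) →
           (P ⊗ Q) (m₀ ∷ m) ≈ ∑[ i < suc m₀ ] ((λ a → P (i ∷ a)) ⊗ (λ a → Q ((m₀ ∸ i) ∷ a))) m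
  ⊗-∷≈∑⊗ P Q m₀ m = trans (⊗-∷≈∑⋆ P Q m₀ m)
    (∑ₗ-∑-comm (below m) (suc m₀) (λ a i → P (i ∷ a) * Q ((m₀ ∸ i) ∷ (m ∸ᵛ a))))

  addAt : ∀ {n} → Mono n → Fin n → ℕ → Mono n
  addAt m j k = updateAt m j (ℕ._+ k)

  ∂ : ∀ {n} → Fin n → ℕ → Poly n → Poly n
  ∂ j k p m = binom (lookup m j ℕ.+ k) k × p (addAt m j k)

  hasse1≋∂ : ∀ {n} (j : Fin n) k p → hasse1 j k p ≋ ∂ j k p
  hasse1≋∂ j k p m = reflexive (≡.trans (·ℕ≡× ((lookup m j ℕ.+ k) C k) (p (addAt m j k)))
                                        (≡.cong (_× p (addAt m j k)) (C≡binom (lookup m j ℕ.+ k) k)))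

  leibniz : ∀ {n} (j : Fin n) k (P Q : Poly n) →
            ∂ j k (P ⊗ Q) ≋ (λ m → ∑[ b < suc k ] (∂ j b P ⊗ ∂ j (k ∸ b) Q) m)
  leibniz zero k P Q (m₀ ∷ m) = begin
      binom (m₀ ℕ.+ k) k × (P ⊗ Q) (m₀ ℕ.+ k ∷ m)
    ≈⟨ ×-congʳ (binom (m₀ ℕ.+ k) k) (⊗-∷≈∑⋆ P Q (m₀ ℕ.+ k) m) ⟩
      binom (m₀ ℕ.+ k) k × ∑[ a ∈ below m ] (P↾ a ⋆ Q↾ a) (m₀ ℕ.+ k)
    ≈⟨ ×-distrib-∑ₗ (below m) (binom (m₀ ℕ.+ k) k) (λ a → (P↾ a ⋆ Q↾ a) (m₀ ℕ.+ k)) ⟩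
      ∑[ a ∈ below m ] ∂₁ k (P↾ a ⋆ Q↾ a) m₀
    ≈⟨ ∑ₗ-cong (below m) (λ a → leibniz₁ (P↾ a) (Q↾ a) m₀ k) ⟩
      ∑[ a ∈ below m ] ∑[ b < suc k ] (∂₁ b (P↾ a) ⋆ ∂₁ (k ∸ b) (Q↾ a)) m₀
    ≈⟨ ∑ₗ-∑-comm (below m) (suc k) (λ a b → (∂₁ b (P↾ a) ⋆ ∂₁ (k ∸ b) (Q↾ a)) m₀) ⟩
      ∑[ b < suc k ] ∑[ a ∈ below m ] (∂₁ b (P↾ a) ⋆ ∂₁ (k ∸ b) (Q↾ a)) m₀
    ≈⟨ ∑-cong (suc k) (λ b → sym (⊗-∷≈∑⋆ (∂ zero b P) (∂ zero (k ∸ b) Q) m₀ m)) ⟩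
      ∑[ b < suc k ] (∂ zero b P ⊗ ∂ zero (k ∸ b) Q) (m₀ ∷ m)
    ∎
    where
    P↾ Q↾ : Mono _ → ℕ → Carrier
    P↾ a i = P (i ∷ a)
    Q↾ a i = Q (i ∷ (m ∸ᵛ a))
  leibniz (suc j) k P Q (m₀ ∷ m) = begin
      binom (lookup m j ℕ.+ k) k × (P ⊗ Q) (m₀ ∷ addAt m j k)
    ≈⟨ ×-congʳ (binom (lookup m j ℕ.+ k) k) (⊗-∷≈∑⊗ P Q m₀ (addAt m j k)) ⟩
      binom (lookup m j ℕ.+ k) k × ∑[ i < suc m₀ ] (P↓ i ⊗ Q↓ (m₀ ∸ i)) (addAt m j k)
    ≈⟨ ×-distrib-∑ (binom (lookup m j ℕ.+ k) k) (suc m₀)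
                   (λ i → (P↓ i ⊗ Q↓ (m₀ ∸ i)) (addAt m j k)) ⟩
      ∑[ i < suc m₀ ] ∂ j k (P↓ i ⊗ Q↓ (m₀ ∸ i)) m
    ≈⟨ ∑-cong (suc m₀) (λ i → leibniz j k (P↓ i) (Q↓ (m₀ ∸ i)) m) ⟩
      ∑[ i < suc m₀ ] ∑[ b < suc k ] (∂ j b (P↓ i) ⊗ ∂ j (k ∸ b) (Q↓ (m₀ ∸ i))) m
    ≈⟨ ∑-comm (suc m₀) (suc k) (λ i b → (∂ j b (P↓ i) ⊗ ∂ j (k ∸ b) (Q↓ (m₀ ∸ i))) m) ⟩
      ∑[ b < suc k ] ∑[ i < suc m₀ ] (∂ j b (P↓ i) ⊗ ∂ j (k ∸ b) (Q↓ (m₀ ∸ i))) m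
    ≈⟨ ∑-cong (suc k) (λ b → sym (⊗-∷≈∑⊗ (∂ (suc j) b P) (∂ (suc j) (k ∸ b) Q) m₀ m)) ⟩
      ∑[ b < suc k ] (∂ (suc j) b P ⊗ ∂ (suc j) (k ∸ b) Q) (m₀ ∷ m)
    ∎
    where
    P↓ Q↓ : ℕ → Poly _
    P↓ i a = P (i ∷ a)
    Q↓ i a = Q (i ∷ a)

  ≋-sym : ∀ {n} {p q : Poly n} → p ≋ q → q ≋ p
  ≋-sym p≋q m = sym (p≋q m)

  ∂-cong : ∀ {n} (j : Fin n) k {p q} → p ≋ q → ∂ j k p ≋ ∂ j k q
  ∂-cong j k p≋q m = ×-congʳ (binom (lookup m j ℕ.+ k) k) (p≋q (addAt m j k))

  ∂-⊕ : ∀ {n} (j : Fin n) k p q → ∂ j k (p ⊕ q) ≋ (∂ j k p ⊕ ∂ j k q)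
  ∂-⊕ j k p q m = ×-distrib-+ (p (addAt m j k)) (q (addAt m j k)) (binom (lookup m j ℕ.+ k) k)

  ∂-zeroP : ∀ {n} (j : Fin n) k → ∂ j k zeroP ≋ zeroP
  ∂-zeroP j k m = ×-zeroʳ (binom (lookup m j ℕ.+ k) k)

  ∂-scaleP : ∀ {n} (j : Fin n) k x p → ∂ j k (scaleP x p) ≋ scaleP x (∂ j k p)
  ∂-scaleP j k x p m = sym (×-comm-* (binom (lookup m j ℕ.+ k) k) x (p (addAt m j k)))

  ∂-identity : ∀ {n} (j : Fin n) p → ∂ j 0 p ≋ p
  ∂-identity j p m = trans (×-homo-1 (p (addAt m j 0)))
    (reflexive (≡.cong p (updateAt-id-local j m (ℕ.+-identityʳ (lookup m j)))))

  ⊗-cong : ∀ {n} {p p′ q q′ : Poly n} → p ≋ p′ → q ≋ q′ → (p ⊗ q) ≋ (p′ ⊗ q′)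
  ⊗-cong p≋p′ q≋q′ m = ∑ₗ-cong (below m) (λ a → *-cong (p≋p′ a) (q≋q′ _))

  ⊗-zeroˡ : ∀ {n} (q : Poly n) → (zeroP ⊗ q) ≋ zeroP
  ⊗-zeroˡ q m = ∑ₗ-zero (below m) (λ a → zeroˡ _)

  ⊗-zeroʳ : ∀ {n} (p : Poly n) → (p ⊗ zeroP) ≋ zeroP
  ⊗-zeroʳ p m = ∑ₗ-zero (below m) (λ a → zeroʳ _)

  ⊗-distribʳ-⊕ : ∀ {n} (q p p′ : Poly n) → ((p ⊕ p′) ⊗ q) ≋ ((p ⊗ q) ⊕ (p′ ⊗ q))
  ⊗-distribʳ-⊕ q p p′ m = trans (∑ₗ-cong (below m) (λ a → distribʳ _ _ _)) (∑ₗ-distrib-+ (below m) _ _)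

  ⊗-distribˡ-⊕ : ∀ {n} (p q q′ : Poly n) → (p ⊗ (q ⊕ q′)) ≋ ((p ⊗ q) ⊕ (p ⊗ q′))
  ⊗-distribˡ-⊕ p q q′ m = trans (∑ₗ-cong (below m) (λ a → distribˡ _ _ _)) (∑ₗ-distrib-+ (below m) _ _)

  ⊗-scalePˡ : ∀ {n} x (p q : Poly n) → (scaleP x p ⊗ q) ≋ scaleP x (p ⊗ q)
  ⊗-scalePˡ x p q m = trans (∑ₗ-cong (below m) (λ a → *-assoc _ _ _)) (sym (*-distribˡ-∑ₗ (below m) x _))

  ⊗-scalePʳ : ∀ {n} x (p q : Poly n) → (p ⊗ scaleP x q) ≋ scaleP x (p ⊗ q)
  ⊗-scalePʳ x p q m =
    trans (∑ₗ-cong (below m) (λ a → x∙yz≈y∙xz (p a) x _)) (sym (*-distribˡ-∑ₗ (below m) x _))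
    where open import Algebra.Properties.CommutativeSemigroup *-commutativeSemigroup using (x∙yz≈y∙xz)

  ⊗-identityˡ : ∀ {n} (q : Poly n) → (constP 1# ⊗ q) ≋ q
  ⊗-identityˡ q []        = trans (+-identityʳ _) (*-identityˡ _)
  ⊗-identityˡ q (m₀ ∷ m) = begin
      (constP 1# ⊗ q) (m₀ ∷ m)
    ≈⟨ ⊗-∷≈∑⊗ (constP 1#) q m₀ m ⟩
      -- constP 1# (i ∷ a) computes to constP 1# a for i = 0 and to 0# otherwise.
      (constP 1# ⊗ q↓ m₀) m + ∑[ i < m₀ ] (zeroP ⊗ q↓ (m₀ ∸ suc i)) m
    ≈⟨ +-cong (⊗-identityˡ (q↓ m₀) m) (∑-zero-< m₀ (λ i _ → ⊗-zeroˡ (q↓ (m₀ ∸ suc i)) m)) ⟩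
      q (m₀ ∷ m) + 0#
    ≈⟨ +-identityʳ _ ⟩
      q (m₀ ∷ m)
    ∎
    where
    q↓ : ℕ → Poly _
    q↓ i a = q (i ∷ a)

  private
    zeros : ∀ n → Mono n
    zeros n = replicate n 0

  monoEq-addAt-suc-zeros : ∀ {n} (j : Fin n) m k → monoEq (addAt m j (suc k)) (zeros n) ≡ false
  monoEq-addAt-suc-zeros zero    (x ∷ m) k rewrite ℕ.+-suc x k = ≡.refl
  monoEq-addAt-suc-zeros (suc j) (x ∷ m) k rewrite monoEq-addAt-suc-zeros j m k = ∧-zeroʳ (x ℕ.≡ᵇ 0)

  monoEq-addAt-2+-unit : ∀ {n} (j t : Fin n) m b → monoEq (addAt m j (suc (suc b))) (unitMono t) ≡ false
  monoEq-addAt-2+-unit zero    zero    (x ∷ m) b rewrite ℕ.+-suc x (suc b) | ℕ.+-suc x b = ≡.refl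
  monoEq-addAt-2+-unit zero    (suc t) (x ∷ m) b rewrite ℕ.+-suc x (suc b) = ≡.refl
  monoEq-addAt-2+-unit (suc j) zero    (x ∷ m) b rewrite monoEq-addAt-suc-zeros j m (suc b) = ∧-zeroʳ (x ℕ.≡ᵇ 1)
  monoEq-addAt-2+-unit (suc j) (suc t) (x ∷ m) b rewrite monoEq-addAt-2+-unit j t m b = ∧-zeroʳ (x ℕ.≡ᵇ 0)

  monoEq-addAt-1-unit-≢ : ∀ {n} (j t : Fin n) m → t ≢ j → monoEq (addAt m j 1) (unitMono t) ≡ false
  monoEq-addAt-1-unit-≢ zero    zero    (x ∷ m) t≢j = contradiction ≡.refl t≢j
  monoEq-addAt-1-unit-≢ zero    (suc t) (x ∷ m) t≢j rewrite ℕ.+-comm x 1 = ≡.refl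
  monoEq-addAt-1-unit-≢ (suc j) zero    (x ∷ m) t≢j rewrite monoEq-addAt-suc-zeros j m 0 = ∧-zeroʳ (x ℕ.≡ᵇ 1)
  monoEq-addAt-1-unit-≢ (suc j) (suc t) (x ∷ m) t≢j
    rewrite monoEq-addAt-1-unit-≢ j t m (t≢j ∘ ≡.cong suc) = ∧-zeroʳ (x ℕ.≡ᵇ 0)

  monoEq-addAt-1-unit : ∀ {n} (j : Fin n) m → monoEq (addAt m j 1) (unitMono j) ≡ monoEq m (zeros n)
  monoEq-addAt-1-unit zero    (zero  ∷ m) = ≡.refl
  monoEq-addAt-1-unit zero    (suc x ∷ m) rewrite ℕ.+-comm x 1 = ≡.refl
  monoEq-addAt-1-unit (suc j) (x ∷ m)     = ≡.cong ((x ℕ.≡ᵇ 0) ∧_) (monoEq-addAt-1-unit j m)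

  monoEq-zeros⇒lookup≡0 : ∀ {n} (j : Fin n) m → monoEq m (zeros n) ≡ true → lookup m j ≡ 0
  monoEq-zeros⇒lookup≡0 zero    (zero  ∷ m) _  = ≡.refl
  monoEq-zeros⇒lookup≡0 (suc j) (zero  ∷ m) eq = monoEq-zeros⇒lookup≡0 j m eq

  ∂-constP : ∀ {n} (j : Fin n) k x → ∂ j (suc k) (constP x) ≋ zeroP
  ∂-constP j k x m rewrite monoEq-addAt-suc-zeros j m k = ×-zeroʳ (binom (lookup m j ℕ.+ suc k) (suc k))

  ∂-varP-≢ : ∀ {n} (j t : Fin n) → t ≢ j → ∂ j 1 (varP t) ≋ zeroP
  ∂-varP-≢ j t t≢j m rewrite monoEq-addAt-1-unit-≢ j t m t≢j = ×-zeroʳ (binom (lookup m j ℕ.+ 1) 1)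

  ∂-varP-2+ : ∀ {n} (j t : Fin n) b → ∂ j (suc (suc b)) (varP t) ≋ zeroP
  ∂-varP-2+ j t b m rewrite monoEq-addAt-2+-unit j t m b = ×-zeroʳ (binom (lookup m j ℕ.+ suc (suc b)) (suc (suc b)))

  ∂-varP : ∀ {n} (j : Fin n) → ∂ j 1 (varP j) ≋ constP 1#
  ∂-varP {n} j m rewrite monoEq-addAt-1-unit j m with monoEq m (zeros n) in m≡0
  ... | true  rewrite monoEq-zeros⇒lookup≡0 j m m≡0 = ×-homo-1 1#
  ... | false = ×-zeroʳ (binom (lookup m j ℕ.+ 1) 1)

  data Span {n} (G : Poly n → Set c) : Poly n → Set (c ⊔ ℓ) where
    gen    : ∀ {p} → G p → Span G p
    zeroₛ  : Span G zeroP
    _⊕ₛ_   : ∀ {p q} → Span G p → Span G q → Span G (p ⊕ q)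
    scaleₛ : ∀ {p} x → Span G p → Span G (scaleP x p)
    respₛ  : ∀ {p q} → p ≋ q → Span G p → Span G q

  private variable
    n : ℕ
    G H K : Poly n → Set c

  Span-map : (∀ {p} → G p → H p) → ∀ {p} → Span G p → Span H p
  Span-map f (gen g)      = gen (f g)
  Span-map f zeroₛ        = zeroₛ
  Span-map f (s ⊕ₛ t)     = Span-map f s ⊕ₛ Span-map f t
  Span-map f (scaleₛ x s) = scaleₛ x (Span-map f s)
  Span-map f (respₛ e s)  = respₛ e (Span-map f s)

  Span-∑ : ∀ k (ps : ℕ → Poly n) → (∀ b → Span G (ps b)) → Span G (λ m → ∑[ b < k ] ps b m)
  Span-∑ zero    ps s = respₛ (λ m → refl) zeroₛ
  Span-∑ (suc k) ps s = respₛ (λ m → refl) (s 0 ⊕ₛ Span-∑ k (ps ∘ suc) (s ∘ suc))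

  ∂-Closed : (Poly n → Set c) → Set (c ⊔ ℓ)
  ∂-Closed {n} G = ∀ {g} → G g → ∀ (j : Fin n) k → Span G (∂ j k g)

  Span-∂ : ∂-Closed G → ∀ {p} → Span G p → ∀ j k → Span G (∂ j k p)
  Span-∂ closed (gen g) j k = closed g j k
  Span-∂ closed zeroₛ j k = respₛ (≋-sym (∂-zeroP j k)) zeroₛ
  Span-∂ closed (_⊕ₛ_ {p} {q} s t) j k =
    respₛ (≋-sym (∂-⊕ j k p q)) (Span-∂ closed s j k ⊕ₛ Span-∂ closed t j k)
  Span-∂ closed (scaleₛ {p} x s) j k = respₛ (≋-sym (∂-scaleP j k x p)) (scaleₛ x (Span-∂ closed s j k))
  Span-∂ closed (respₛ e s) j k = respₛ (∂-cong j k e) (Span-∂ closed s j k)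

  Span-hasse : ∂-Closed G → ∀ {p} → Span G p → ∀ i → Span G (hasse i p)
  Span-hasse {n} {G} closed {p} s i = go (Vec.zip (Vec.allFin n) i)
    where
    fold : ∀ {k} → Vec (Fin n Σ.× ℕ) k → Poly n
    fold = Vec.foldr _ (λ jk q → hasse1 (Σ.proj₁ jk) (Σ.proj₂ jk) q) p
    go : ∀ {k} (jks : Vec (Fin n Σ.× ℕ) k) → Span G (fold jks)
    go []             = s
    go ((j , k) ∷ jks) = respₛ (≋-sym (hasse1≋∂ j k (fold jks))) (Span-∂ closed (go jks) j k)

  Span-⊗ʳ : ∀ {g} → (∀ {h} → H h → Span K (g ⊗ h)) → ∀ {q} → Span H q → Span K (g ⊗ q)
  Span-⊗ʳ         f (gen h)                = f h
  Span-⊗ʳ {g = g} f zeroₛ                  = respₛ (≋-sym (⊗-zeroʳ g)) zeroₛ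
  Span-⊗ʳ {g = g} f (_⊕ₛ_ {q} {q′} s t)    =
    respₛ (≋-sym (⊗-distribˡ-⊕ g q q′)) (Span-⊗ʳ f s ⊕ₛ Span-⊗ʳ f t)
  Span-⊗ʳ {g = g} f (scaleₛ {q} x s)       = respₛ (≋-sym (⊗-scalePʳ x g q)) (scaleₛ x (Span-⊗ʳ f s))
  Span-⊗ʳ         f (respₛ e s)            = respₛ (⊗-cong (λ m → refl) e) (Span-⊗ʳ f s)

  Span-⊗ : (∀ {g h} → G g → H h → Span K (g ⊗ h)) → ∀ {p q} → Span G p → Span H q → Span K (p ⊗ q)
  Span-⊗ f         (gen g)               t = Span-⊗ʳ (f g) t
  Span-⊗ f {q = q} zeroₛ                 t = respₛ (≋-sym (⊗-zeroˡ q)) zeroₛ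
  Span-⊗ f {q = q} (_⊕ₛ_ {p} {p′} s s′)  t =
    respₛ (≋-sym (⊗-distribʳ-⊕ q p p′)) (Span-⊗ f s t ⊕ₛ Span-⊗ f s′ t)
  Span-⊗ f {q = q} (scaleₛ {p} x s)      t = respₛ (≋-sym (⊗-scalePˡ x p q)) (scaleₛ x (Span-⊗ f s t))
  Span-⊗ f {q = q} (respₛ e s)           t = respₛ (⊗-cong {q = q} e (λ m → refl)) (Span-⊗ f s t)

  Combination : ∀ {B} → Vec (Poly n) B → Poly n → Set (c ⊔ ℓ)
  Combination {B = B} gs p = Σ (Vec Carrier B) λ cs → linComb cs gs ≋ p

  linComb-zeros : ∀ {B} (gs : Vec (Poly n) B) → linComb (replicate B 0#) gs ≋ zeroP
  linComb-zeros []       m = refl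
  linComb-zeros (g ∷ gs) m = trans (+-cong (zeroˡ _) (linComb-zeros gs m)) (+-identityˡ 0#)

  linComb-+ : ∀ {B} (cs ds : Vec Carrier B) (gs : Vec (Poly n) B) →
              linComb (zipWith _+_ cs ds) gs ≋ (linComb cs gs ⊕ linComb ds gs)
  linComb-+ []       []       []       m = sym (+-identityˡ 0#)
  linComb-+ (x ∷ cs) (y ∷ ds) (g ∷ gs) m =
    trans (+-cong (distribʳ (g m) x y) (linComb-+ cs ds gs m)) (interchange (x * g m) (y * g m) _ _)

  linComb-scale : ∀ {B} x (cs : Vec Carrier B) (gs : Vec (Poly n) B) →
                  linComb (Vec.map (x *_) cs) gs ≋ scaleP x (linComb cs gs)
  linComb-scale x []       []       m = sym (zeroʳ x)
  linComb-scale x (y ∷ cs) (g ∷ gs) m =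
    trans (+-cong (*-assoc x y (g m)) (linComb-scale x cs gs m)) (sym (distribˡ x _ _))

  ∈⇒Combination : ∀ {B} {gs : Vec (Poly n) B} {p} → p ∈ gs → Combination gs p
  ∈⇒Combination {gs = g ∷ gs} (here ≡.refl) =
    1# ∷ replicate _ 0# , λ m → trans (+-cong (*-identityˡ (g m)) (linComb-zeros gs m)) (+-identityʳ (g m))
  ∈⇒Combination {gs = g ∷ gs} (there p∈gs) with ∈⇒Combination p∈gs
  ... | cs , e = 0# ∷ cs , λ m → trans (+-cong (zeroˡ (g m)) (e m)) (+-identityˡ _)

  Span⇒Combination : ∀ {B} {gs : Vec (Poly n) B} → (∀ {p} → G p → p ∈ gs) →
                     ∀ {p} → Span G p → Combination gs p
  Span⇒Combination ∈gs (gen g) = ∈⇒Combination (∈gs g)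
  Span⇒Combination {gs = gs} ∈gs zeroₛ = replicate _ 0# , linComb-zeros gs
  Span⇒Combination {gs = gs} ∈gs (s ⊕ₛ t) with Span⇒Combination ∈gs s | Span⇒Combination ∈gs t
  ... | cs , e | ds , e′ = zipWith _+_ cs ds , λ m → trans (linComb-+ cs ds gs m) (+-cong (e m) (e′ m))
  Span⇒Combination {gs = gs} ∈gs (scaleₛ x s) with Span⇒Combination ∈gs s
  ... | cs , e = Vec.map (x *_) cs , λ m → trans (linComb-scale x cs gs m) (*-congˡ (e m))
  Span⇒Combination ∈gs (respₛ p≋q s) with Span⇒Combination ∈gs s
  ... | cs , e = cs , λ m → trans (e m) (p≋q m)

  Span-∂-constP1 : G (constP 1#) → ∀ j k → Span G (∂ j k (constP 1#))
  Span-∂-constP1 g j zero    = respₛ (≋-sym (∂-identity j (constP 1#))) (gen g)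
  Span-∂-constP1 g j (suc k) = respₛ (≋-sym (∂-constP j k 1#)) zeroₛ

  IsOne : Poly n → Set c
  IsOne p = p ≡ constP 1#

  ∂-varP-∈ : ∀ (j t : Fin n) b → Span IsOne (∂ j (suc b) (varP t))
  ∂-varP-∈ j t (suc b) = respₛ (≋-sym (∂-varP-2+ j t b)) zeroₛ
  ∂-varP-∈ j t zero with t Fin.≟ j
  ... | yes ≡.refl = respₛ (≋-sym (∂-varP j)) (gen ≡.refl)
  ... | no  t≢j    = respₛ (≋-sym (∂-varP-≢ j t t≢j)) zeroₛ

  ∂-linear-∈ : ∀ {k} (j : Fin n) b (a : Vec Carrier k) (ts : Vec (Fin n) k) →
               Span IsOne (∂ j (suc b) (sumP (zipWith scaleP a (Vec.map varP ts))))
  ∂-linear-∈ j b []      []       = respₛ (≋-sym (∂-zeroP j (suc b))) zeroₛ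
  ∂-linear-∈ j b (x ∷ a) (t ∷ ts) = respₛ split (scaleₛ x (∂-varP-∈ j t b) ⊕ₛ ∂-linear-∈ j b a ts)
    where
    rest = sumP (zipWith scaleP a (Vec.map varP ts))
    split : (scaleP x (∂ j (suc b) (varP t)) ⊕ ∂ j (suc b) rest) ≋ ∂ j (suc b) (scaleP x (varP t) ⊕ rest)
    split m = sym (trans (∂-⊕ j (suc b) (scaleP x (varP t)) rest m) (+-congʳ (∂-scaleP j (suc b) x (varP t) m)))

  ∂-affine-∈ : ∀ (j : Fin n) b L → Span IsOne (∂ j (suc b) (affineP L))
  ∂-affine-∈ {n} j b (affine a₀ a) =
    respₛ (≋-sym (∂-⊕ j (suc b) (constP a₀) (sumP (zipWith scaleP a (Vec.map varP (Vec.allFin n))))))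
    (respₛ (≋-sym (∂-constP j b a₀)) zeroₛ ⊕ₛ ∂-linear-∈ j b a (Vec.allFin n))

  AffineOrOne : Affine n → Poly n → Set c
  AffineOrOne L p = p ≡ affineP L ⊎ p ≡ constP 1#

  ∂-affine : ∀ (j : Fin n) b L → Span (AffineOrOne L) (∂ j b (affineP L))
  ∂-affine j zero    L = respₛ (≋-sym (∂-identity j (affineP L))) (gen (inj₁ ≡.refl))
  ∂-affine j (suc b) L = Span-map inj₂ (∂-affine-∈ j b L)

  PowerBelow : Affine n → ℕ → Poly n → Set c
  PowerBelow L i p = Σ ℕ λ i′ → i′ ℕ.≤ i Σ.× p ≡ affineP L ^P i′

  ∂-power : ∀ (j : Fin n) b L i → Span (PowerBelow L i) (∂ j b (affineP L ^P i))
  ∂-power j b L zero    = Span-∂-constP1 (0 , z≤n , ≡.refl) j b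
  ∂-power j b L (suc i) = respₛ (≋-sym (leibniz j b (affineP L) (affineP L ^P i)))
    (Span-∑ (suc b) _ (λ b′ → Span-⊗ multiply (∂-affine j b′ L) (∂-power j (b ∸ b′) L i)))
    where
    multiply : ∀ {g h} → AffineOrOne L g → PowerBelow L i h → Span (PowerBelow L (suc i)) (g ⊗ h)
    multiply (inj₁ ≡.refl) (i′ , i′≤i , ≡.refl) = gen (suc i′ , s≤s i′≤i , ≡.refl)
    multiply (inj₂ ≡.refl) (i′ , i′≤i , ≡.refl) =
      respₛ (≋-sym (⊗-identityˡ _)) (gen (i′ , ℕ.m≤n⇒m≤1+n i′≤i , ≡.refl))

  PowVecBelow : ∀ {k} → Vec (Affine n) k → Vec ℕ k → Poly n → Set c
  PowVecBelow {k = k} L e p = Σ (Vec ℕ k) λ d → Pointwise ℕ._≤_ d e Σ.× p ≡ powVec L d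

  ∂-powVec : ∀ {k} (j : Fin n) b (L : Vec (Affine n) k) d → Span (PowVecBelow L d) (∂ j b (powVec L d))
  ∂-powVec j b []       []       = Span-∂-constP1 ([] , [] , ≡.refl) j b
  ∂-powVec j b (L₀ ∷ L) (d₀ ∷ d) = respₛ (≋-sym (leibniz j b (affineP L₀ ^P d₀) (powVec L d)))
    (Span-∑ (suc b) _ (λ b′ → Span-⊗ multiply (∂-power j b′ L₀ d₀) (∂-powVec j (b ∸ b′) L d)))
    where
    multiply : ∀ {g h} → PowerBelow L₀ d₀ g → PowVecBelow L d h →
               Span (PowVecBelow (L₀ ∷ L) (d₀ ∷ d)) (g ⊗ h)
    multiply (i , i≤d₀ , ≡.refl) (d′ , d′≤d , ≡.refl) = gen (i ∷ d′ , i≤d₀ ∷ d′≤d , ≡.refl)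

  TermGenerator : Term n → Poly n → Set c
  TermGenerator (term _ L e) = PowVecBelow L e

  Generator : List (Term n) → Poly n → Set c
  Generator ts p = Any (λ t → TermGenerator t p) ts

  ∂-closed-TermGenerator : ∀ (t : Term n) → ∂-Closed (TermGenerator t)
  ∂-closed-TermGenerator (term _ L e) (d , d≤e , ≡.refl) j k =
    Span-map (λ { (d′ , d′≤d , eq) → d′ , Pointwise.trans ℕ.≤-trans d′≤d d≤e , eq }) (∂-powVec j k L d)

  ∂-closed-Generator : ∀ (ts : List (Term n)) → ∂-Closed (Generator ts)
  ∂-closed-Generator (t ∷ ts) (Any.here g)  j k = Span-map Any.here (∂-closed-TermGenerator t g j k)
  ∂-closed-Generator (t ∷ ts) (Any.there g) j k = Span-map Any.there (∂-closed-Generator ts g j k)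

  sumTerms∈Span : ∀ (ts : List (Term n)) → Span (Generator ts) (sumTerms ts)
  sumTerms∈Span []                   = zeroₛ
  sumTerms∈Span (term _ L e ∷ ts) =
    gen (Any.here (e , Pointwise.refl ℕ.≤-refl , ≡.refl)) ⊕ₛ Span-map Any.there (sumTerms∈Span ts)

  prependEach : ∀ {k p} (x : ℕ) → Vec (Vec ℕ k) p → Vec (Vec ℕ (suc k)) (suc x ℕ.* p)
  prependEach zero    ds = Vec.map (0 ∷_) ds Vec.++ []
  prependEach (suc x) ds = Vec.map (suc x ∷_) ds Vec.++ prependEach x ds

  allBelow : ∀ {k} (e : Vec ℕ k) → Vec (Vec ℕ k) (prodSuc e)
  allBelow []      = [] ∷ []
  allBelow (a ∷ e) = prependEach a (allBelow e)

  ∈-prependEach : ∀ {k p d₀ x} {d : Vec ℕ k} {ds : Vec (Vec ℕ k) p} →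
                  d₀ ℕ.≤ x → d ∈ ds → (d₀ ∷ d) ∈ prependEach x ds
  ∈-prependEach {x = zero}  z≤n d∈ds = ∈-++⁺ˡ (∈-map⁺ (0 ∷_) d∈ds)
  ∈-prependEach {x = suc x} {ds = ds} d₀≤x d∈ds with ℕ.m≤n⇒m<n∨m≡n d₀≤x
  ... | inj₂ ≡.refl     = ∈-++⁺ˡ (∈-map⁺ (suc x ∷_) d∈ds)
  ... | inj₁ (s≤s d₀<x) = ∈-++⁺ʳ (Vec.map (suc x ∷_) ds) (∈-prependEach d₀<x d∈ds)

  ∈-allBelow : ∀ {k} {d e : Vec ℕ k} → Pointwise ℕ._≤_ d e → d ∈ allBelow e
  ∈-allBelow []            = here ≡.refl
  ∈-allBelow (d₀≤e₀ ∷ d≤e) = ∈-prependEach d₀≤e₀ (∈-allBelow d≤e)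

  generators : ∀ (ts : List (Term n)) → Vec (Poly n) (sum (map weight ts))
  generators []                = []
  generators (term _ L e ∷ ts) = Vec.map (powVec L) (allBelow e) Vec.++ generators ts

  ∈-generators : ∀ (ts : List (Term n)) {p} → Generator ts p → p ∈ generators ts
  ∈-generators (term _ L e ∷ ts) (Any.here (d , d≤e , ≡.refl)) =
    ∈-++⁺ˡ (∈-map⁺ (powVec L) (∈-allBelow d≤e))
  ∈-generators (term _ L e ∷ ts) (Any.there g) = ∈-++⁺ʳ (Vec.map (powVec L) (allBelow e)) (∈-generators ts g)

lemma6p6 : ∀ {c ℓ : Level} (F : Field c ℓ) (n : ℕ) (ts : List (Poly.Term F n)) →
    Poly.DerivDimLE F (Poly.sumTerms F ts) (sum (map (Poly.weight F) ts))
lemma6p6 F n ts = generators ts , λ i →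
  Span⇒Combination (∈-generators ts) (Span-hasse (∂-closed-Generator ts) (sumTerms∈Span ts) i)
  where open PolyTheory F
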